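{- Let $p$ be a prime, $n$ a positive integer, and let $C$ be a convex subset of $\mathbb Q_p^n$ with $C\subsetneq\mathbb Z_p^n$. Then there is a ball of radius $\frac1p$ contained in $\mathbb Z_p^n$ which is disjoint from $C$.
   Context: $\mathbb Q_p$ denotes the $p$-adic numbers, $\mathbb Z_p$ the $p$-adic integers, $|\cdot|$ the $p$-adic absolute value with $|p|=\frac1p$, and $\|(x_1,\dots,x_n)\|=\max_i|x_i|$ on $\mathbb Q_p^n$. A ball of radius $\rho$ is a set $B(v,\rho)=\{u\in\mathbb Q_p^n:\|u-v\|\le\rho\}$. A subset $C\subset\mathbb Q_p^n$ is called convex if it is empty or a coset $L+u$ of a $\mathbb Z_p$-submodule $L$ of $\mathbb Q_p^n$. -}

module Defs where

open import Data.Nat as ℕ using (ℕ; suc)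
open import Data.Integer as ℤ using (ℤ; +_; _+_; _-_; _*_; -_)
open import Data.Integer.Tactic.RingSolver using (solve-∀)
open import Data.Fin using (Fin)
open import Data.Product using (Σ; _×_; _,_; ∃)
open import Data.Sum using (_⊎_)
open import Relation.Nullary using (¬_)
open import Relation.Binary.PropositionalEquality using (_≡_; refl; trans; cong; cong₂; sym)

Cong : ℤ → ℤ → ℤ → Set
Cong d x y = Σ ℤ λ q → x - y ≡ q * d

private
  id-+ : ∀ x y x' y' → (x + y) - (x' + y') ≡ (x - x') + (y - y')
  id-+ = solve-∀
  id-* : ∀ x y x' y' → x * y - x' * y' ≡ x * (y - y') + (x - x') * y'
  id-* = solve-∀
  id-neg : ∀ x x' → (- x) - (- x') ≡ - (x - x')
  id-neg = solve-∀
  id-d1 : ∀ a b d → a * d + b * d ≡ (a + b) * d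
  id-d1 = solve-∀
  id-d2 : ∀ x a b d → x * (b * d) + (a * d) * b ≡ (x * b + a * b) * d
  id-d2 = solve-∀
  id-d3 : ∀ a d → - (a * d) ≡ (- a) * d
  id-d3 = solve-∀
  id-d4 : ∀ x b y a d → x * (b * d) + (a * d) * y ≡ (x * b + a * y) * d
  id-d4 = solve-∀
  id-0 : ∀ c d → c - c ≡ + 0 * d
  id-0 = solve-∀

Cong-+ : ∀ {d x y x' y'} → Cong d x x' → Cong d y y' → Cong d (x + y) (x' + y')
Cong-+ {d} {x} {y} {x'} {y'} (a , ea) (b , eb) =
  a + b , trans (id-+ x y x' y') (trans (cong₂ _+_ ea eb) (id-d1 a b d))

Cong-* : ∀ {d x y x' y'} → Cong d x x' → Cong d y y' → Cong d (x * y) (x' * y')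
Cong-* {d} {x} {y} {x'} {y'} (a , ea) (b , eb) =
  x * b + a * y' ,
  trans (id-* x y x' y')
    (trans (cong₂ (λ u v → x * u + v * y') eb ea) (id-d4 x b y' a d))

Cong-neg : ∀ {d x x'} → Cong d x x' → Cong d (- x) (- x')
Cong-neg {d} {x} {x'} (a , ea) = - a , trans (id-neg x x') (trans (cong -_ ea) (id-d3 a d))

Cong-refl : ∀ {d} c → Cong d c c
Cong-refl {d} c = + 0 , id-0 c d

-- The p-adic integers ℤ_p, as the inverse limit of ℤ/p^kℤ:
-- a sequence (x_k) of integers with x_{k+1} ≡ x_k (mod p^k);
-- two such sequences are equal iff x_k ≡ y_k (mod p^k) for all k.

module PAdic (p : ℕ) where

  pw : ℕ → ℤ
  pw k = + (p ℕ.^ k)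

  record ℤₚ : Set where
    constructor mkℤₚ
    field
      seq : ℕ → ℤ
      coh : ∀ k → Cong (pw k) (seq (suc k)) (seq k)
  open ℤₚ public

  _≈ᶻ_ : ℤₚ → ℤₚ → Set
  x ≈ᶻ y = ∀ k → Cong (pw k) (seq x k) (seq y k)

  ι : ℤ → ℤₚ
  ι c = mkℤₚ (λ _ → c) (λ k → Cong-refl c)

  _+ᶻ_ : ℤₚ → ℤₚ → ℤₚ
  x +ᶻ y = mkℤₚ (λ k → seq x k + seq y k) (λ k → Cong-+ {pw k} {seq x (suc k)} {seq y (suc k)} {seq x k} {seq y k} (coh x k) (coh y k))

  _*ᶻ_ : ℤₚ → ℤₚ → ℤₚ
  x *ᶻ y = mkℤₚ (λ k → seq x k * seq y k) (λ k → Cong-* {pw k} {seq x (suc k)} {seq y (suc k)} {seq x k} {seq y k} (coh x k) (coh y k))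

  -ᶻ_ : ℤₚ → ℤₚ
  -ᶻ x = mkℤₚ (λ k → - seq x k) (λ k → Cong-neg {pw k} {seq x (suc k)} {seq x k} (coh x k))

  -- The p-adic numbers ℚ_p: a pair (e , a) stands for a / p^e.

  record ℚₚ : Set where
    constructor _/p^_
    field
      num : ℤₚ
      den : ℕ
  open ℚₚ public

  _≈_ : ℚₚ → ℚₚ → Set
  (a /p^ e) ≈ (b /p^ f) = (ι (pw f) *ᶻ a) ≈ᶻ (ι (pw e) *ᶻ b)

  _⊕_ : ℚₚ → ℚₚ → ℚₚ
  (a /p^ e) ⊕ (b /p^ f) = ((ι (pw f) *ᶻ a) +ᶻ (ι (pw e) *ᶻ b)) /p^ (e ℕ.+ f)

  ⊝_ : ℚₚ → ℚₚ
  ⊝ (a /p^ e) = (-ᶻ a) /p^ e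

  _⊖_ : ℚₚ → ℚₚ → ℚₚ
  x ⊖ y = x ⊕ (⊝ y)

  _·_ : ℤₚ → ℚₚ → ℚₚ
  c · (a /p^ e) = (c *ᶻ a) /p^ e

  𝟘 : ℚₚ
  𝟘 = ι (+ 0) /p^ 0

  ⟦_⟧ : ℤₚ → ℚₚ
  ⟦ a ⟧ = a /p^ 0

  -- |x| ≤ p^(-m)  (i.e. x ∈ p^m ℤ_p); for m = 0 this is x ∈ ℤ_p.
  AbsLe : ℕ → ℚₚ → Set
  AbsLe m x = Σ ℤₚ λ a → x ≈ ⟦ ι (pw m) *ᶻ a ⟧

  Vecₚ : ℕ → Set
  Vecₚ n = Fin n → ℚₚ

  module _ {n : ℕ} where

    _≈ⁿ_ : Vecₚ n → Vecₚ n → Set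
    u ≈ⁿ v = ∀ i → u i ≈ v i

    _⊕ⁿ_ : Vecₚ n → Vecₚ n → Vecₚ n
    (u ⊕ⁿ v) i = u i ⊕ v i

    _⊖ⁿ_ : Vecₚ n → Vecₚ n → Vecₚ n
    (u ⊖ⁿ v) i = u i ⊖ v i

    _·ⁿ_ : ℤₚ → Vecₚ n → Vecₚ n
    (c ·ⁿ v) i = c · v i

    𝟘ⁿ : Vecₚ n
    𝟘ⁿ i = 𝟘

    NormLe : ℕ → Vecₚ n → Set
    NormLe m u = ∀ i → AbsLe m (u i)

    Inℤₚⁿ : Vecₚ n → Set
    Inℤₚⁿ u = NormLe 0 u

    InBall1/p : Vecₚ n → Vecₚ n → Set
    InBall1/p v u = NormLe 1 (u ⊖ⁿ v)

  record Submodule (n : ℕ) : Set₁ where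
    field
      mem     : Vecₚ n → Set
      resp    : ∀ {u v} → u ≈ⁿ v → mem u → mem v
      has-𝟘   : mem 𝟘ⁿ
      closed+ : ∀ {u v} → mem u → mem v → mem (u ⊕ⁿ v)
      closed· : ∀ c {u} → mem u → mem (c ·ⁿ u)
  open Submodule public

  -- convex: empty, or a coset L + u of a ℤ_p-submodule L
  Convex : (n : ℕ) → (Vecₚ n → Set) → Set₁
  Convex n C =
    (∀ x → ¬ C x)
    ⊎ Σ (Submodule n) λ L → Σ (Vecₚ n) λ u →
        ∀ x → (C x → Σ (Vecₚ n) λ l → mem L l × (x ≈ⁿ (l ⊕ⁿ u)))
            × ((Σ (Vecₚ n) λ l → mem L l × (x ≈ⁿ (l ⊕ⁿ u))) → C x)

{-# OPTIONS --safe #-}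
module Submission where

-- If C = L + u is nonempty then u ∈ ℤₚⁿ. Suppose every ball B(u + eⱼ, 1/p) met C, say in
-- lⱼ + u with lⱼ ∈ L. Then lⱼ ≡ eⱼ (mod p), so the lⱼ are the rows of a matrix I + pT, which is
-- invertible over ℤₚ with inverse the Neumann series Σₘ (-pT)ᵐ. Hence L ⊇ ℤₚⁿ and
-- C ⊇ ℤₚⁿ + u = ℤₚⁿ, a contradiction; so one of these balls, all of which lie in ℤₚⁿ, misses C.
-- Which one cannot be decided, hence the double negation.

open import Defs
open import Data.Nat using (ℕ; _≤_)
open import Data.Nat.Primality using (Prime)
open import Data.Product using (Σ; _×_)
open import Relation.Nullary using (¬_)

open import Data.Empty using (⊥)
open import Data.Fin using (Fin; zero; suc)
open import Data.Fin.Properties using (∀-cons)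
open import Data.Integer as ℤ using (ℤ; +_; 0ℤ; 1ℤ; _+_; _-_; _*_; -_; _^_)
open import Data.Integer.Divisibility.Signed
  using (_∣_; divides; ∣m∣n⇒∣m+n; ∣m⇒∣-m; ∣m⇒∣m*n; *-monoʳ-∣)
import Data.Integer.Properties as ℤ
open import Algebra.Properties.CommutativeSemigroup ℤ.*-commutativeSemigroup using (x∙yz≈y∙xz)
open import Algebra.Properties.Semiring.Sum ℤ.+-*-semiring
  using (sum; ∑-distrib-+; *-distribˡ-sum; sum-cong-≗; sum-replicate-zero)
open import Data.Integer.Tactic.RingSolver using (solve-∀)
open import Data.Nat as ℕ using (zero; suc; NonZero)
import Data.Nat.Properties as ℕ
open import Data.Nat.Primality using (prime⇒nonZero)
open import Data.Product using (_,_; proj₁; proj₂)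
open import Data.Sum using (inj₁; inj₂)
open import Data.Vec.Functional using (Vector; foldr)
open import Level using (0ℓ)
open import Relation.Binary.Bundles using (Setoid)
open import Relation.Binary.PropositionalEquality
  using (_≡_; refl; sym; trans; cong; cong₂; subst; module ≡-Reasoning)
open import Relation.Binary.Structures using (IsEquivalence)

-- Congruences of integers

-- A record rather than Cong itself, so that d, x and y can be inferred from a proof.
infix 4 _≡_mod_
record _≡_mod_ (x y d : ℤ) : Set where
  constructor fromCong
  field toCong : Cong d x y
open _≡_mod_ public

module _ {d : ℤ} where

  ≡-mod-refl : ∀ {x} → x ≡ x mod d
  ≡-mod-refl {x} = fromCong (Cong-refl x)

  ≡-mod-reflexive : ∀ {x y} → x ≡ y → x ≡ y mod d
  ≡-mod-reflexive refl = ≡-mod-refl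

  ≡-mod-sym : ∀ {x y} → x ≡ y mod d → y ≡ x mod d
  ≡-mod-sym {x} {y} (fromCong (q , e)) = fromCong (- q , (begin
      y - x      ≡⟨ swap x y ⟩
      - (x - y)  ≡⟨ cong -_ e ⟩
      - (q * d)  ≡⟨ ℤ.neg-distribˡ-* q d ⟩
      - q * d    ∎))
    where
    open ≡-Reasoning
    swap : ∀ x y → y - x ≡ - (x - y)
    swap = solve-∀

  ≡-mod-trans : ∀ {x y z} → x ≡ y mod d → y ≡ z mod d → x ≡ z mod d
  ≡-mod-trans {x} {y} {z} (fromCong (a , ea)) (fromCong (b , eb)) = fromCong (a + b , (begin
      x - z              ≡⟨ telescope x y z ⟩
      (x - y) + (y - z)  ≡⟨ cong₂ _+_ ea eb ⟩
      a * d + b * d      ≡⟨ ℤ.*-distribʳ-+ d a b ⟨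
      (a + b) * d        ∎))
    where
    open ≡-Reasoning
    telescope : ∀ x y z → x - z ≡ (x - y) + (y - z)
    telescope = solve-∀

  ≡-mod-isEquivalence : IsEquivalence (λ x y → x ≡ y mod d)
  ≡-mod-isEquivalence = record { refl = ≡-mod-refl ; sym = ≡-mod-sym ; trans = ≡-mod-trans }

  +-cong-mod : ∀ {x x' y y'} → x ≡ x' mod d → y ≡ y' mod d → x + y ≡ x' + y' mod d
  +-cong-mod {x} {x'} {y} {y'} (fromCong a) (fromCong b) =
    fromCong (Cong-+ {d} {x} {y} {x'} {y'} a b)

  *-cong-mod : ∀ {x x' y y'} → x ≡ x' mod d → y ≡ y' mod d → x * y ≡ x' * y' mod d
  *-cong-mod {x} {x'} {y} {y'} (fromCong a) (fromCong b) =
    fromCong (Cong-* {d} {x} {y} {x'} {y'} a b)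

  *-congˡ-mod : ∀ c {y y'} → y ≡ y' mod d → c * y ≡ c * y' mod d
  *-congˡ-mod c = *-cong-mod (≡-mod-refl {c})

  neg-cong-mod : ∀ {x x'} → x ≡ x' mod d → - x ≡ - x' mod d
  neg-cong-mod {x} {x'} (fromCong a) = fromCong (Cong-neg {d} {x} {x'} a)

  sum-cong-mod : ∀ {m} {f g : Vector ℤ m} → (∀ j → f j ≡ g j mod d) → sum f ≡ sum g mod d
  sum-cong-mod {zero}  f≡g = ≡-mod-refl
  sum-cong-mod {suc m} f≡g = +-cong-mod (f≡g zero) (sum-cong-mod (λ j → f≡g (suc j)))

  ∣⇒≡0-mod : ∀ {x} → d ∣ x → x ≡ 0ℤ mod d
  ∣⇒≡0-mod {x} (divides q e) = fromCong (q , trans (ℤ.+-identityʳ x) e)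

≡-mod-setoid : ℤ → Setoid 0ℓ 0ℓ
≡-mod-setoid d = record { isEquivalence = ≡-mod-isEquivalence {d} }

module ≡-mod-Reasoning (d : ℤ) where
  open import Relation.Binary.Reasoning.Setoid (≡-mod-setoid d) public

*-cancelˡ-mod : ∀ c {x y d} .{{_ : ℤ.NonZero c}} → c * x ≡ c * y mod c * d → x ≡ y mod d
*-cancelˡ-mod c {x} {y} {d} (fromCong (q , e)) =
  fromCong (q , ℤ.*-cancelˡ-≡ c (x - y) (q * d) (begin
    c * (x - y)    ≡⟨ distrib c x y ⟩
    c * x - c * y  ≡⟨ e ⟩
    q * (c * d)    ≡⟨ x∙yz≈y∙xz q c d ⟩
    c * (q * d)    ∎))
  where
  open ≡-Reasoning
  distrib : ∀ c x y → c * (x - y) ≡ c * x - c * y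
  distrib = solve-∀

∣-sum : ∀ {d m} {f : Vector ℤ m} → (∀ j → d ∣ f j) → d ∣ sum f
∣-sum {d} {zero}  d∣f = divides 0ℤ refl
∣-sum {d} {suc m} d∣f = ∣m∣n⇒∣m+n (d∣f zero) (∣-sum (λ j → d∣f (suc j)))

-- Neumann series for I + P·T over ℤ

Matrix : ℕ → Set
Matrix n = Fin n → Fin n → ℤ

infixl 7 _⊛_

_⊛_ : ∀ {n} → Vector ℤ n → Matrix n → Vector ℤ n
(v ⊛ T) i = sum (λ j → v j * T j i)

δ : ∀ {n} → Matrix n
δ zero    zero    = 1ℤ
δ zero    (suc _) = 0ℤ
δ (suc _) zero    = 0ℤ
δ (suc j) (suc i) = δ j i

⊛-zeroˡ : ∀ {n} (T : Matrix n) i → ((λ _ → 0ℤ) ⊛ T) i ≡ 0ℤ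
⊛-zeroˡ {n} T i = sum-replicate-zero n

⊛-distribʳ-+ : ∀ {n} (a b : Vector ℤ n) T i →
               ((λ j → a j + b j) ⊛ T) i ≡ (a ⊛ T) i + (b ⊛ T) i
⊛-distribʳ-+ a b T i = trans
  (sum-cong-≗ (λ j → ℤ.*-distribʳ-+ (T j i) (a j) (b j)))
  (∑-distrib-+ (λ j → a j * T j i) (λ j → b j * T j i))

⊛-identityʳ : ∀ {n} (v : Vector ℤ n) i → (v ⊛ δ) i ≡ v i
⊛-identityʳ {suc n} v zero = begin
    v zero * 1ℤ + sum (λ j → v (suc j) * 0ℤ)  ≡⟨ cong₂ _+_ (ℤ.*-identityʳ (v zero)) zeros ⟩
    v zero + 0ℤ                               ≡⟨ ℤ.+-identityʳ (v zero) ⟩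
    v zero                                    ∎
  where
  open ≡-Reasoning
  zeros : sum (λ j → v (suc j) * 0ℤ) ≡ 0ℤ
  zeros = trans (sum-cong-≗ (λ j → ℤ.*-zeroʳ (v (suc j)))) (sum-replicate-zero n)
⊛-identityʳ {suc n} v (suc i) = begin
    v zero * 0ℤ + (v∘suc ⊛ δ) i  ≡⟨ cong (_+ (v∘suc ⊛ δ) i) (ℤ.*-zeroʳ (v zero)) ⟩
    0ℤ + (v∘suc ⊛ δ) i           ≡⟨ ℤ.+-identityˡ _ ⟩
    (v∘suc ⊛ δ) i                ≡⟨ ⊛-identityʳ v∘suc i ⟩
    v (suc i)                     ∎
  where
  open ≡-Reasoning
  v∘suc : Vector ℤ n
  v∘suc j = v (suc j)

⊛-δ+P* : ∀ {n} (v : Vector ℤ n) P (T : Matrix n) i →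
         (v ⊛ (λ j i → δ j i + P * T j i)) i ≡ v i + P * (v ⊛ T) i
⊛-δ+P* v P T i = begin
    sum (λ j → v j * (δ j i + P * T j i))
  ≡⟨ sum-cong-≗ (λ j → expand (v j) (δ j i) P (T j i)) ⟩
    sum (λ j → v j * δ j i + P * (v j * T j i))
  ≡⟨ ∑-distrib-+ (λ j → v j * δ j i) (λ j → P * (v j * T j i)) ⟩
    (v ⊛ δ) i + sum (λ j → P * (v j * T j i))
  ≡⟨ cong₂ _+_ (⊛-identityʳ v i) (sym (*-distribˡ-sum P (λ j → v j * T j i))) ⟩
    v i + P * (v ⊛ T) i
  ∎
  where
  open ≡-Reasoning
  expand : ∀ c e P t → c * (e + P * t) ≡ c * e + P * (c * t)
  expand = solve-∀

module NeumannSeries {n : ℕ} (P : ℤ) (T : Matrix n) (X : Vector ℤ n) where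

  term : ℕ → Vector ℤ n
  term zero      = X
  term (suc m) i = - (P * (term m ⊛ T) i)

  partialSum : ℕ → Vector ℤ n
  partialSum zero    i = 0ℤ
  partialSum (suc m) i = partialSum m i + term m i

  partialSum-solves : ∀ m i → partialSum m i + P * (partialSum m ⊛ T) i ≡ X i - term m i
  partialSum-solves zero i = begin
      0ℤ + P * ((λ _ → 0ℤ) ⊛ T) i  ≡⟨ cong (λ s → 0ℤ + P * s) (⊛-zeroˡ T i) ⟩
      0ℤ + P * 0ℤ                  ≡⟨ cancel P (X i) ⟩
      X i - X i                    ∎
    where
    open ≡-Reasoning
    cancel : ∀ P x → 0ℤ + P * 0ℤ ≡ x - x
    cancel = solve-∀
  partialSum-solves (suc m) i = begin
      S i + t i + P * ((λ j → S j + t j) ⊛ T) i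
    ≡⟨ cong (λ s → S i + t i + P * s) (⊛-distribʳ-+ S t T i) ⟩
      S i + t i + P * ((S ⊛ T) i + (t ⊛ T) i)
    ≡⟨ regroup (S i) (t i) P ((S ⊛ T) i) ((t ⊛ T) i) ⟩
      (S i + P * (S ⊛ T) i) + t i + P * (t ⊛ T) i
    ≡⟨ cong (λ s → s + t i + P * (t ⊛ T) i) (partialSum-solves m i) ⟩
      (X i - t i) + t i + P * (t ⊛ T) i
    ≡⟨ telescope (X i) (t i) (P * (t ⊛ T) i) ⟩
      X i - term (suc m) i
    ∎
    where
    open ≡-Reasoning
    S t : Vector ℤ n
    S = partialSum m
    t = term m
    regroup : ∀ s t P a b → s + t + P * (a + b) ≡ (s + P * a) + t + P * b
    regroup = solve-∀
    telescope : ∀ x t u → (x - t) + t + u ≡ x - - u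
    telescope = solve-∀

  term-divisible : ∀ m i → P ^ m ∣ term m i
  term-divisible zero    i = divides (X i) (sym (ℤ.*-identityʳ (X i)))
  term-divisible (suc m) i =
    ∣m⇒∣-m (*-monoʳ-∣ P (∣-sum (λ j → ∣m⇒∣m*n (T j i) (term-divisible m j))))

module _ {n : ℕ} (P : ℤ) {d : ℤ} {T T' : Matrix n} {X X' : Vector ℤ n}
         (T≡T' : ∀ j i → T j i ≡ T' j i mod d) (X≡X' : ∀ i → X i ≡ X' i mod d) where
  open NeumannSeries

  term-cong-mod : ∀ m i → term P T X m i ≡ term P T' X' m i mod d
  term-cong-mod zero    i = X≡X' i
  term-cong-mod (suc m) i =
    neg-cong-mod (*-congˡ-mod P (sum-cong-mod (λ j → *-cong-mod (term-cong-mod m j) (T≡T' j i))))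

  partialSum-cong-mod : ∀ m i → partialSum P T X m i ≡ partialSum P T' X' m i mod d
  partialSum-cong-mod zero    i = ≡-mod-refl
  partialSum-cong-mod (suc m) i = +-cong-mod (partialSum-cong-mod m i) (term-cong-mod m i)

¬¬-pull-Fin : ∀ {n} {P : Fin n → Set} → (∀ j → ¬ ¬ P j) → ¬ ¬ (∀ j → P j)
¬¬-pull-Fin {zero}  ¬¬P ¬∀P = ¬∀P λ ()
¬¬-pull-Fin {suc n} ¬¬P ¬∀P =
  ¬¬P zero λ P0 → ¬¬-pull-Fin (λ j → ¬¬P (suc j)) λ ∀Psuc → ¬∀P (∀-cons P0 ∀Psuc)

-- p-adic integers inside ℚₚ

module PAdicProperties (p : ℕ) .{{p≢0 : NonZero p}} where
  open PAdic p

  pw-+ : ∀ m k → pw (m ℕ.+ k) ≡ pw m * pw k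
  pw-+ m k = trans (cong +_ (ℕ.^-distribˡ-+-* p m k)) (ℤ.pos-* (p ℕ.^ m) (p ℕ.^ k))

  pw-^ : ∀ k → pw k ≡ pw 1 ^ k
  pw-^ zero    = refl
  pw-^ (suc k) = trans (pw-+ 1 k) (cong (pw 1 *_) (pw-^ k))

  ≡-mod-pw-weaken : ∀ j k {x y} → x ≡ y mod pw (j ℕ.+ k) → x ≡ y mod pw k
  ≡-mod-pw-weaken j k {x} {y} (fromCong (q , e)) = fromCong (q * pw j , (begin
      x - y              ≡⟨ e ⟩
      q * pw (j ℕ.+ k)   ≡⟨ cong (q *_) (pw-+ j k) ⟩
      q * (pw j * pw k)  ≡⟨ ℤ.*-assoc q (pw j) (pw k) ⟨
      q * pw j * pw k    ∎))
    where open ≡-Reasoning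

  seq-coh : ∀ (a : ℤₚ) j k → seq a (j ℕ.+ k) ≡ seq a k mod pw k
  seq-coh a zero    k = ≡-mod-refl
  seq-coh a (suc j) k =
    ≡-mod-trans (≡-mod-pw-weaken j k (fromCong (coh a (j ℕ.+ k)))) (seq-coh a j k)

  pw-*-cancelˡ : ∀ m {a b} → (ι (pw m) *ᶻ a) ≈ᶻ (ι (pw m) *ᶻ b) → a ≈ᶻ b
  pw-*-cancelˡ m {a} {b} pa≈pb k = toCong (begin
      seq a k          ≈⟨ seq-coh a m k ⟨
      seq a (m ℕ.+ k)  ≈⟨ *-cancelˡ-mod (pw m) {{ℕ.m^n≢0 p m}} pa≡pb ⟩
      seq b (m ℕ.+ k)  ≈⟨ seq-coh b m k ⟩
      seq b k          ∎)
    where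
    open ≡-mod-Reasoning (pw k)
    pa≡pb : pw m * seq a (m ℕ.+ k) ≡ pw m * seq b (m ℕ.+ k) mod pw m * pw k
    pa≡pb = subst (pw m * seq a (m ℕ.+ k) ≡ pw m * seq b (m ℕ.+ k) mod_)
                  (pw-+ m k) (fromCong (pa≈pb (m ℕ.+ k)))

  -- x ≃⟦ a ⟧ is x ≈ ⟦ a ⟧ stated levelwise, without the factor p⁰ that cross-multiplying by the
  -- denominator of ⟦ a ⟧ introduces.
  infix 4 _≃⟦_⟧
  record _≃⟦_⟧ (x : ℚₚ) (a : ℤₚ) : Set where
    constructor mk≃
    field ≃-at : ∀ k → seq (num x) k ≡ pw (den x) * seq a k mod pw k
  open _≃⟦_⟧

  ≈⟦⟧⇒≃ : ∀ {x a} → x ≈ ⟦ a ⟧ → x ≃⟦ a ⟧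
  ≈⟦⟧⇒≃ x≈a = mk≃ λ k →
    ≡-mod-trans (≡-mod-reflexive (sym (ℤ.*-identityˡ _))) (fromCong (x≈a k))

  ≃⇒≈⟦⟧ : ∀ {x a} → x ≃⟦ a ⟧ → x ≈ ⟦ a ⟧
  ≃⇒≈⟦⟧ x≃a k = toCong (≡-mod-trans (≡-mod-reflexive (ℤ.*-identityˡ _)) (≃-at x≃a k))

  ⟦⟧-≃ : ∀ a → ⟦ a ⟧ ≃⟦ a ⟧
  ⟦⟧-≃ a = mk≃ λ k → ≡-mod-reflexive (sym (ℤ.*-identityˡ (seq a k)))

  ≃-resp-≈ᶻ : ∀ {x a b} → x ≃⟦ a ⟧ → a ≈ᶻ b → x ≃⟦ b ⟧
  ≃-resp-≈ᶻ {x} x≃a a≈b = mk≃ λ k →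
    ≡-mod-trans (≃-at x≃a k) (*-congˡ-mod (pw (den x)) (fromCong (a≈b k)))

  ≃-resp-≈ : ∀ {x y a} → x ≈ y → x ≃⟦ a ⟧ → y ≃⟦ a ⟧
  ≃-resp-≈ {ζ /p^ h} {η /p^ g} {a} x≈y x≃a = mk≃ λ k →
    fromCong (pw-*-cancelˡ h {η} {ι (pw g) *ᶻ a} scaled k)
    where
    scaled : (ι (pw h) *ᶻ η) ≈ᶻ (ι (pw h) *ᶻ (ι (pw g) *ᶻ a))
    scaled k = toCong (begin
      pw h * seq η k           ≈⟨ fromCong (x≈y k) ⟨
      pw g * seq ζ k           ≈⟨ *-congˡ-mod (pw g) (≃-at x≃a k) ⟩
      pw g * (pw h * seq a k)  ≡⟨ x∙yz≈y∙xz (pw g) (pw h) (seq a k) ⟩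
      pw h * (pw g * seq a k)  ∎)
      where open ≡-mod-Reasoning (pw k)

  ≃⇒≈ : ∀ {x y a b} → x ≃⟦ a ⟧ → y ≃⟦ b ⟧ → a ≈ᶻ b → x ≈ y
  ≃⇒≈ {α /p^ e} {β /p^ f} {a} {b} x≃a y≃b a≈b k = toCong (begin
      pw f * seq α k           ≈⟨ *-congˡ-mod (pw f) (≃-at x≃a k) ⟩
      pw f * (pw e * seq a k)  ≈⟨ *-congˡ-mod (pw f) (*-congˡ-mod (pw e) (fromCong (a≈b k))) ⟩
      pw f * (pw e * seq b k)  ≡⟨ x∙yz≈y∙xz (pw f) (pw e) (seq b k) ⟩
      pw e * (pw f * seq b k)  ≈⟨ *-congˡ-mod (pw e) (≃-at y≃b k) ⟨
      pw e * seq β k           ∎)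
    where open ≡-mod-Reasoning (pw k)

  ⊕-≃ : ∀ {x y a b} → x ≃⟦ a ⟧ → y ≃⟦ b ⟧ → x ⊕ y ≃⟦ a +ᶻ b ⟧
  ⊕-≃ {α /p^ e} {β /p^ f} {a} {b} x≃a y≃b = mk≃ λ k →
    let open ≡-mod-Reasoning (pw k) in begin
      pw f * seq α k + pw e * seq β k
    ≈⟨ +-cong-mod (*-congˡ-mod (pw f) (≃-at x≃a k)) (*-congˡ-mod (pw e) (≃-at y≃b k)) ⟩
      pw f * (pw e * seq a k) + pw e * (pw f * seq b k)
    ≡⟨ collect (pw e) (pw f) (seq a k) (seq b k) ⟩
      pw e * pw f * (seq a k + seq b k)
    ≡⟨ cong (_* (seq a k + seq b k)) (pw-+ e f) ⟨
      pw (e ℕ.+ f) * (seq a k + seq b k)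
    ∎
    where
    collect : ∀ E F a b → F * (E * a) + E * (F * b) ≡ E * F * (a + b)
    collect = solve-∀

  ⊕-cancelʳ-≃ : ∀ {x y b c} → x ⊕ y ≃⟦ c ⟧ → y ≃⟦ b ⟧ → x ≃⟦ c +ᶻ (-ᶻ b) ⟧
  ⊕-cancelʳ-≃ {λ' /p^ g} {β /p^ f} {b} {c} x⊕y≃c y≃b = mk≃ λ k →
    fromCong (pw-*-cancelˡ f {λ'} {ι (pw g) *ᶻ (c +ᶻ (-ᶻ b))} scaled k)
    where
    scaled : (ι (pw f) *ᶻ λ') ≈ᶻ (ι (pw f) *ᶻ (ι (pw g) *ᶻ (c +ᶻ (-ᶻ b))))
    scaled k = toCong (begin
        pw f * seq λ' k
      ≡⟨ add-sub (pw f * seq λ' k) (pw g * seq β k) ⟩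
        (pw f * seq λ' k + pw g * seq β k) - pw g * seq β k
      ≈⟨ +-cong-mod (≃-at x⊕y≃c k) (neg-cong-mod (*-congˡ-mod (pw g) (≃-at y≃b k))) ⟩
        pw (g ℕ.+ f) * seq c k - pw g * (pw f * seq b k)
      ≡⟨ cong (λ P → P * seq c k - pw g * (pw f * seq b k)) (pw-+ g f) ⟩
        pw g * pw f * seq c k - pw g * (pw f * seq b k)
      ≡⟨ collect (pw g) (pw f) (seq c k) (seq b k) ⟩
        pw f * (pw g * (seq c k + - seq b k))
      ∎)
      where
      open ≡-mod-Reasoning (pw k)
      add-sub : ∀ u v → u ≡ (u + v) - v
      add-sub = solve-∀
      collect : ∀ G F c b → G * F * c - G * (F * b) ≡ F * (G * (c + - b))
      collect = solve-∀

  ⊝-≃ : ∀ {x a} → x ≃⟦ a ⟧ → ⊝ x ≃⟦ -ᶻ a ⟧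
  ⊝-≃ {α /p^ e} {a} x≃a = mk≃ λ k →
    ≡-mod-trans (neg-cong-mod (≃-at x≃a k)) (≡-mod-reflexive (ℤ.neg-distribʳ-* (pw e) (seq a k)))

  ·-≃ : ∀ c {x a} → x ≃⟦ a ⟧ → c · x ≃⟦ c *ᶻ a ⟧
  ·-≃ c {α /p^ e} {a} x≃a = mk≃ λ k →
    ≡-mod-trans (*-congˡ-mod (seq c k) (≃-at x≃a k))
                (≡-mod-reflexive (x∙yz≈y∙xz (seq c k) (pw e) (seq a k)))

  ≃⇒ℤₚ : ∀ {x a} → x ≃⟦ a ⟧ → AbsLe 0 x
  ≃⇒ℤₚ {a = a} x≃a = a , ≃⇒≈⟦⟧ (≃-resp-≈ᶻ {b = ι (pw 0) *ᶻ a} x≃a one-*)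
    where
    one-* : a ≈ᶻ (ι (pw 0) *ᶻ a)
    one-* k = toCong (≡-mod-reflexive (sym (ℤ.*-identityˡ (seq a k))))

  ℤₚ⇒≃ : ∀ {x} → AbsLe 0 x → Σ ℤₚ λ a → x ≃⟦ a ⟧
  ℤₚ⇒≃ (a , x≈a) = ι (pw 0) *ᶻ a , ≈⟦⟧⇒≃ x≈a

  𝟘-⊕-≈ : ∀ x → x ≈ (𝟘 ⊕ x)
  𝟘-⊕-≈ (α /p^ e) k = toCong (≡-mod-reflexive (pad (pw e) (seq α k)))
    where
    pad : ∀ E a → E * a ≡ E * (E * 0ℤ + 1ℤ * a)
    pad = solve-∀

  sumᶻ : ∀ {m} → Vector ℤₚ m → ℤₚ
  sumᶻ = foldr _+ᶻ_ (ι 0ℤ)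

  seq-sumᶻ : ∀ {m} (f : Vector ℤₚ m) k → seq (sumᶻ f) k ≡ sum (λ j → seq (f j) k)
  seq-sumᶻ {zero}  f k = refl
  seq-sumᶻ {suc m} f k = cong (λ s → seq (f zero) k + s) (seq-sumᶻ (λ j → f (suc j)) k)

  infixl 7 _⊛ᶻ_

  _⊛ᶻ_ : ∀ {n} → Vector ℤₚ n → (Fin n → Fin n → ℤₚ) → Vector ℤₚ n
  (c ⊛ᶻ M) i = sumᶻ (λ j → c j *ᶻ M j i)

  I+p· : ∀ {n} → (Fin n → Fin n → ℤₚ) → Fin n → Fin n → ℤₚ
  I+p· T j i = ι (δ j i) +ᶻ (ι (pw 1) *ᶻ T j i)

  -- At level k take the k-th partial Neumann sum of the level-k truncations: it solves the
  -- system modulo pᵏ because its error term is divisible by pᵏ, and for the same reason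
  -- consecutive levels agree modulo pᵏ.
  I+p·-surjective : ∀ {n} (T : Fin n → Fin n → ℤₚ) (y : Vector ℤₚ n) →
                    Σ (Vector ℤₚ n) λ c → ∀ i → (c ⊛ᶻ I+p· T) i ≈ᶻ y i
  I+p·-surjective {n} T y = c , solves
    where
    open NeumannSeries (pw 1)

    Tₖ : ℕ → Matrix n
    Tₖ k j i = seq (T j i) k

    yₖ cₖ : ℕ → Vector ℤ n
    yₖ k i = seq (y i) k
    cₖ k = partialSum (Tₖ k) (yₖ k) k

    term≡0 : ∀ {T X} k i → term T X k i ≡ 0ℤ mod pw k
    term≡0 {T} {X} k i =
      ∣⇒≡0-mod (subst (_∣ term T X k i) (sym (pw-^ k)) (term-divisible T X k i))

    cₖ-coh : ∀ j k → Cong (pw k) (cₖ (suc k) j) (cₖ k j)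
    cₖ-coh j k = toCong (begin
        partialSum (Tₖ (suc k)) (yₖ (suc k)) k j + term (Tₖ (suc k)) (yₖ (suc k)) k j
      ≈⟨ +-cong-mod (partialSum-cong-mod (pw 1) (λ j i → fromCong (coh (T j i) k))
                                               (λ i → fromCong (coh (y i) k)) k j)
                    (term≡0 k j) ⟩
        cₖ k j + 0ℤ
      ≡⟨ ℤ.+-identityʳ (cₖ k j) ⟩
        cₖ k j
      ∎)
      where open ≡-mod-Reasoning (pw k)

    c : Vector ℤₚ n
    c j = mkℤₚ (λ k → cₖ k j) (cₖ-coh j)

    solves : ∀ i → (c ⊛ᶻ I+p· T) i ≈ᶻ y i
    solves i k = toCong (begin
        seq ((c ⊛ᶻ I+p· T) i) k
      ≡⟨ seq-sumᶻ (λ j → c j *ᶻ I+p· T j i) k ⟩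
        (cₖ k ⊛ (λ j i → δ j i + pw 1 * Tₖ k j i)) i
      ≡⟨ ⊛-δ+P* (cₖ k) (pw 1) (Tₖ k) i ⟩
        cₖ k i + pw 1 * (cₖ k ⊛ Tₖ k) i
      ≡⟨ partialSum-solves (Tₖ k) (yₖ k) k i ⟩
        yₖ k i - term (Tₖ k) (yₖ k) k i
      ≈⟨ +-cong-mod (≡-mod-refl {x = yₖ k i}) (neg-cong-mod (term≡0 k i)) ⟩
        yₖ k i - 0ℤ
      ≡⟨ ℤ.+-identityʳ (yₖ k i) ⟩
        yₖ k i
      ∎)
      where open ≡-mod-Reasoning (pw k)

  ∑ⁿ : ∀ {n m} → Vector (Vecₚ n) m → Vecₚ n
  ∑ⁿ = foldr _⊕ⁿ_ 𝟘ⁿ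

  ∑ⁿ-mem : ∀ {n m} (L : Submodule n) {f : Vector (Vecₚ n) m} →
           (∀ j → mem L (f j)) → mem L (∑ⁿ f)
  ∑ⁿ-mem {m = zero}  L f∈L = has-𝟘 L
  ∑ⁿ-mem {m = suc m} L f∈L = closed+ L (f∈L zero) (∑ⁿ-mem L (λ j → f∈L (suc j)))

  ∑ⁿ-≃ : ∀ {n m} {f : Vector (Vecₚ n) m} {a : Vector ℤₚ m} i →
         (∀ j → f j i ≃⟦ a j ⟧) → ∑ⁿ f i ≃⟦ sumᶻ a ⟧
  ∑ⁿ-≃ {m = zero}  i f≃a = ⟦⟧-≃ (ι 0ℤ)
  ∑ⁿ-≃ {m = suc m} i f≃a = ⊕-≃ (f≃a zero) (∑ⁿ-≃ i (λ j → f≃a (suc j)))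

  I+p·-rows-span-ℤₚⁿ : ∀ {n} (L : Submodule n) (l : Vector (Vecₚ n) n)
    (T : Fin n → Fin n → ℤₚ) → (∀ j → mem L (l j)) → (∀ j i → l j i ≃⟦ I+p· T j i ⟧) →
    (y : Vector ℤₚ n) → Σ (Vecₚ n) λ m → mem L m × (∀ i → m i ≃⟦ y i ⟧)
  I+p·-rows-span-ℤₚⁿ L l T l∈L l≃ y =
      ∑ⁿ (λ j → c j ·ⁿ l j)
    , ∑ⁿ-mem L (λ j → closed· L (c j) (l∈L j))
    , λ i → ≃-resp-≈ᶻ (∑ⁿ-≃ i (λ j → ·-≃ (c j) (l≃ j i))) (proj₂ (I+p·-surjective T y) i)
    where
    c = proj₁ (I+p·-surjective T y)

  ball-≃ : ∀ {v a} w → v ≃⟦ a ⟧ → AbsLe 1 (w ⊖ v) →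
           Σ ℤₚ λ t → w ≃⟦ a +ᶻ (ι (pw 1) *ᶻ t) ⟧
  ball-≃ {v} {a} w v≃a (t , w-v≈pt) = t , ≃-resp-≈ᶻ (⊕-cancelʳ-≃ {w} {⊝ v} w-v≃pt (⊝-≃ v≃a)) reorder
    where
    w-v≃pt : w ⊖ v ≃⟦ ι (pw 1) *ᶻ t ⟧
    w-v≃pt = ≈⟦⟧⇒≃ {w ⊖ v} w-v≈pt
    reorder : ((ι (pw 1) *ᶻ t) +ᶻ (-ᶻ (-ᶻ a))) ≈ᶻ (a +ᶻ (ι (pw 1) *ᶻ t))
    reorder k = toCong (≡-mod-reflexive (comm (pw 1 * seq t k) (seq a k)))
      where
      comm : ∀ s a → s + - - a ≡ a + s
      comm = solve-∀

  ball⊆ℤₚⁿ : ∀ {n} {v : Vecₚ n} {a : Vector ℤₚ n} →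
            (∀ i → v i ≃⟦ a i ⟧) → ∀ w → InBall1/p v w → Inℤₚⁿ w
  ball⊆ℤₚⁿ v≃a w w∈B i = ≃⇒ℤₚ (proj₂ (ball-≃ (w i) (v≃a i) (w∈B i)))

  eⁿ : ∀ {n} → Fin n → Vecₚ n
  eⁿ j i = ⟦ ι (δ j i) ⟧

  InCoset : ∀ {n} → Submodule n → Vecₚ n → Vecₚ n → Set
  InCoset {n} L u x = Σ (Vecₚ n) λ l → mem L l × (x ≈ⁿ (l ⊕ⁿ u))

  coset-meeting-unit-balls-⊇ℤₚⁿ : ∀ {n} (L : Submodule n) (u : Vecₚ n) (μ : Vector ℤₚ n) →
    (∀ i → u i ≃⟦ μ i ⟧) →
    (∀ j → Σ (Vecₚ n) λ w → InBall1/p (u ⊕ⁿ eⁿ j) w × InCoset L u w) →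
    ∀ x → Inℤₚⁿ x → InCoset L u x
  coset-meeting-unit-balls-⊇ℤₚⁿ {n} L u μ u≃μ meets x x∈ℤₚⁿ =
    m , proj₁ (proj₂ spanned) , x≈m+u
    where
    w : Fin n → Vecₚ n
    w j = proj₁ (meets j)

    w∈L+u : ∀ j → InCoset L u (w j)
    w∈L+u j = proj₂ (proj₂ (meets j))

    l : Fin n → Vecₚ n
    l j = proj₁ (w∈L+u j)

    near : ∀ j i → Σ ℤₚ λ t → w j i ≃⟦ (μ i +ᶻ ι (δ j i)) +ᶻ (ι (pw 1) *ᶻ t) ⟧
    near j i = ball-≃ (w j i) (⊕-≃ (u≃μ i) (⟦⟧-≃ (ι (δ j i)))) (proj₁ (proj₂ (meets j)) i)

    t : Fin n → Fin n → ℤₚ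
    t j i = proj₁ (near j i)

    l≃ : ∀ j i → l j i ≃⟦ I+p· t j i ⟧
    l≃ j i = ≃-resp-≈ᶻ (⊕-cancelʳ-≃ (≃-resp-≈ w≈l+u (proj₂ (near j i))) (u≃μ i)) drop-μ
      where
      w≈l+u : w j i ≈ (l j i ⊕ u i)
      w≈l+u = proj₂ (proj₂ (w∈L+u j)) i
      drop-μ : (((μ i +ᶻ ι (δ j i)) +ᶻ (ι (pw 1) *ᶻ t j i)) +ᶻ (-ᶻ μ i)) ≈ᶻ I+p· t j i
      drop-μ k = toCong (≡-mod-reflexive (cancel (seq (μ i) k) (δ j i) (pw 1 * seq (t j i) k)))
        where
        cancel : ∀ m e s → m + e + s + - m ≡ e + s
        cancel = solve-∀

    ξ : ∀ i → Σ ℤₚ λ a → x i ≃⟦ a ⟧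
    ξ i = ℤₚ⇒≃ {x i} (x∈ℤₚⁿ i)

    spanned : Σ (Vecₚ n) λ m → mem L m × (∀ i → m i ≃⟦ proj₁ (ξ i) +ᶻ (-ᶻ μ i) ⟧)
    spanned = I+p·-rows-span-ℤₚⁿ L l t (λ j → proj₁ (proj₂ (w∈L+u j))) l≃
                                 (λ i → proj₁ (ξ i) +ᶻ (-ᶻ μ i))

    m : Vecₚ n
    m = proj₁ spanned

    x≈m+u : x ≈ⁿ (m ⊕ⁿ u)
    x≈m+u i = ≃⇒≈ (proj₂ (ξ i)) (⊕-≃ (proj₂ (proj₂ spanned) i) (u≃μ i)) sub-add
      where
      sub-add : proj₁ (ξ i) ≈ᶻ ((proj₁ (ξ i) +ᶻ (-ᶻ μ i)) +ᶻ μ i)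
      sub-add k = toCong (≡-mod-reflexive (identity (seq (proj₁ (ξ i)) k) (seq (μ i) k)))
        where
        identity : ∀ a b → a ≡ a + - b + b
        identity = solve-∀

proposition2p4 : (p : ℕ) → Prime p → (n : ℕ) → 1 ≤ n →
    let open PAdic p in
    (C : Vecₚ n → Set) → Convex n C →
    (∀ x → C x → Inℤₚⁿ x) → ¬ (∀ x → Inℤₚⁿ x → C x) →
    ¬ ¬ (Σ (Vecₚ n) λ v →
          (∀ u → InBall1/p v u → Inℤₚⁿ u) × (∀ u → InBall1/p v u → ¬ C u))
proposition2p4 p p-prime n _ C convex C⊆ℤₚⁿ ℤₚⁿ⊈C no-ball = by-cases convex
  where
  instance
    p≢0 : NonZero p
    p≢0 = prime⇒nonZero p-prime
  open PAdic p
  open PAdicProperties p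

  by-cases : Convex n C → ⊥
  by-cases (inj₁ C-empty) =
    no-ball (𝟘ⁿ , ball⊆ℤₚⁿ (λ _ → ⟦⟧-≃ (ι 0ℤ)) , λ w _ → C-empty w)
  by-cases (inj₂ (L , u , coset)) = ¬¬-pull-Fin meets λ all-meet →
    ℤₚⁿ⊈C λ x x∈ℤₚⁿ →
      proj₂ (coset x) (coset-meeting-unit-balls-⊇ℤₚⁿ L u μ u≃μ all-meet x x∈ℤₚⁿ)
    where
    u∈C : C u
    u∈C = proj₂ (coset u) (𝟘ⁿ , has-𝟘 L , λ i → 𝟘-⊕-≈ (u i))

    μ : Vector ℤₚ n
    μ i = proj₁ (ℤₚ⇒≃ {u i} (C⊆ℤₚⁿ u u∈C i))

    u≃μ : ∀ i → u i ≃⟦ μ i ⟧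
    u≃μ i = proj₂ (ℤₚ⇒≃ {u i} (C⊆ℤₚⁿ u u∈C i))

    meets : ∀ j → ¬ ¬ (Σ (Vecₚ n) λ w → InBall1/p (u ⊕ⁿ eⁿ j) w × InCoset L u w)
    meets j misses = no-ball
      ( u ⊕ⁿ eⁿ j
      , ball⊆ℤₚⁿ (λ i → ⊕-≃ (u≃μ i) (⟦⟧-≃ (ι (δ j i))))
      , λ w w∈B w∈C → misses (w , w∈B , proj₁ (coset w) w∈C))
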